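{- Let $\Sigma=(G,\sigma)$ be a $2$-connected signed graph (with $G$ simple and finite) and $n$ a positive integer. Then $\Sigma$ is balanced if and only if $\Sigma^n=(G^n,\sigma')$ is balanced (i.e. the $n^{th}$ power of $\Sigma$ is unique and the signed graph $\Sigma^n$ is balanced).
   Context: A signed graph $\Sigma=(G,\sigma)$ consists of a graph $G=(V,E)$ and a signature $\sigma:E\to\{1,-1\}$; the sign of a path or cycle is the product of its edge signs, and a signed graph is balanced if all of its cycles have positive sign. For vertices $u,v$, $d(u,v)$ is the distance and $\mathcal{P}_{(u,v)}$ the set of shortest $u$–$v$ paths; $\sigma_{\max}(u,v)=\max\{\sigma(P):P\in\mathcal{P}_{(u,v)}\}$, $\sigma_{\min}(u,v)=\min\{\sigma(P):P\in\mathcal{P}_{(u,v)}\}$. The $n^{th}$ power $G^n$ has vertex set $V$, with $u\ne v$ adjacent iff $d(u,v)\le n$; $\Sigma_{\max}^n=(G^n,\sigma')$ with $\sigma'(uv)=\sigma_{\max}(u,v)$ and $\Sigma_{\min}^n=(G^n,\sigma'')$ with $\sigma''(uv)=\sigma_{\min}(u,v)$. The $n^{th}$ power is unique when $\Sigma_{\max}^n=\Sigma_{\min}^n$, and this common signed graph is denoted $\Sigma^n$. -}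

module Defs where

open import Data.Nat using (ℕ; _≤_)
open import Data.Fin using (Fin)
open import Data.Bool using (Bool; true; false)
open import Data.Sign using (Sign; +; -) renaming (_*_ to _*ˢ_)
open import Data.List using (List; []; _∷_; drop)
open import Data.List.Membership.Propositional using (_∈_; _∉_)
open import Data.List.Relation.Unary.Unique.Propositional using (Unique)
open import Data.Product using (Σ; ∃; _×_; _,_)
open import Relation.Binary.PropositionalEquality using (_≡_; _≢_)

data _≤ˢ_ : Sign → Sign → Set where
  -≤ : ∀ {s} → - ≤ˢ s
  +≤+ : + ≤ˢ +

module _ {k : ℕ} (Adj : Fin k → Fin k → Set) where

  data Walk : Fin k → Fin k → Set where
    [_]  : (v : Fin k) → Walk v v
    step : (u : Fin k) {v w : Fin k} → Adj u v → Walk v w → Walk u w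

  verts : ∀ {u v} → Walk u v → List (Fin k)
  verts [ v ]          = v ∷ []
  verts (step u _ p)   = u ∷ verts p

  len : ∀ {u v} → Walk u v → ℕ
  len [ v ]          = 0
  len (step u _ p)   = Data.Nat.suc (len p)

  IsPath : ∀ {u v} → Walk u v → Set
  IsPath p = Unique (verts p)

  -- a cycle: a closed walk v₀ v₁ … v_{m-1} v₀ with m ≥ 3 and
  -- v₁, …, v_{m-1}, v₀ pairwise distinct
  IsCycle : ∀ {u} → Walk u u → Set
  IsCycle c = (3 ≤ len c) × Unique (drop 1 (verts c))

  walkSign : (∀ {u v} → Adj u v → Sign) → ∀ {u v} → Walk u v → Sign
  walkSign sg [ v ]        = +
  walkSign sg (step u e p) = sg e *ˢ walkSign sg p

  Balanced : (∀ {u v} → Adj u v → Sign) → Set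
  Balanced sg = ∀ {u} (c : Walk u u) → IsCycle c → walkSign sg c ≡ +

  Dist : Fin k → Fin k → ℕ → Set
  Dist u v m = (Σ (Walk u v) λ p → len p ≡ m) × (∀ (q : Walk u v) → m ≤ len q)

  IsShortestPath : ∀ {u v} → Walk u v → Set
  IsShortestPath {u} {v} p = IsPath p × Dist u v (len p)

  Connected : Set
  Connected = ∀ u v → Walk u v

  -- G - x is connected: any two vertices other than x are joined by a
  -- walk avoiding x
  ConnectedWithout : Fin k → Set
  ConnectedWithout x =
    ∀ u v → u ≢ x → v ≢ x → Σ (Walk u v) λ p → x ∉ verts p

  TwoConnected : Set
  TwoConnected = (3 ≤ k) × Connected × (∀ x → ConnectedWithout x)

-- Finite simple signed graphs on vertex set Fin k.
-- adj is symmetric and irreflexive (simple graph); the signature σ is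
-- given by sgn, symmetric; its values on non-edges are irrelevant.

record SignedGraph (k : ℕ) : Set where
  field
    adj     : Fin k → Fin k → Bool
    adj-sym : ∀ u v → adj u v ≡ adj v u
    adj-irr : ∀ u → adj u u ≡ false
    sgn     : Fin k → Fin k → Sign
    sgn-sym : ∀ u v → sgn u v ≡ sgn v u

module _ {k : ℕ} (S : SignedGraph k) where
  open SignedGraph S

  E : Fin k → Fin k → Set
  E u v = adj u v ≡ true

  σ : ∀ {u v} → E u v → Sign
  σ {u} {v} _ = sgn u v

  PowAdj : ℕ → Fin k → Fin k → Set
  PowAdj n u v = (u ≢ v) × ∃ λ m → Dist E u v m × m ≤ n

  IsSigmaMax : Fin k → Fin k → Sign → Set
  IsSigmaMax u v s =
    (Σ (Walk E u v) λ p → IsShortestPath E p × walkSign E σ p ≡ s)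
    × (∀ (p : Walk E u v) → IsShortestPath E p → walkSign E σ p ≤ˢ s)

  IsSigmaMin : Fin k → Fin k → Sign → Set
  IsSigmaMin u v s =
    (Σ (Walk E u v) λ p → IsShortestPath E p × walkSign E σ p ≡ s)
    × (∀ (p : Walk E u v) → IsShortestPath E p → s ≤ˢ walkSign E σ p)

  -- Σ^n is unique with signature σ' : σ'(uv) = σ_max(u,v) = σ_min(u,v)
  -- for every edge uv of G^n
  IsUniquePowerSignature : (n : ℕ) → (∀ {u v} → PowAdj n u v → Sign) → Set
  IsUniquePowerSignature n σ' =
    ∀ {u v} (e : PowAdj n u v) → IsSigmaMax u v (σ' e) × IsSigmaMin u v (σ' e)

-- A signed graph is balanced iff every closed walk is positive: a closed walk
-- through a repeated vertex splits into two shorter closed walks, and a closed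
-- walk without one is a cycle or a backtrack u v u, whose sign is σ(uv)² = +.
-- So in a balanced graph the sign of a walk depends only on its end points;
-- all shortest u–v paths then have the same sign, making the power Σⁿ unique,
-- and a closed walk of Gⁿ expands, edge by edge, into a positive closed walk
-- of G. Conversely G is a signed subgraph of Σⁿ for n ≥ 1, so cycles of G are
-- cycles of Σⁿ. Neither direction uses 2-connectedness.
module Submission where

open import Defs
open import Data.Nat using (ℕ; suc; _≤_; z≤n; s≤s) renaming (_+_ to _+ℕ_)
open import Data.Nat.Properties using (≤-trans; ≤-refl; n≤1+n; m≤m+n; m≤n+m)
open import Data.Fin using (Fin; _≟_)
open import Data.Sign using (Sign; +; -) renaming (_*_ to _*ˢ_)
open import Data.Sign.Properties using (*-assoc; *-comm; *-identityʳ; s*s≡+; *-cancelˡ-≡)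
open import Data.Empty using (⊥-elim)
open import Data.Product using (Σ; _×_; _,_; proj₁; proj₂)
open import Data.List using (_∷_; drop)
open import Data.List.Relation.Unary.Any using (here; there)
open import Data.List.Relation.Unary.All using ([]; _∷_)
open import Data.List.Relation.Unary.All.Properties using (¬Any⇒All¬)
open import Data.List.Relation.Unary.AllPairs using ([]; _∷_)
open import Data.List.Relation.Unary.Unique.Propositional using (Unique)
open import Data.List.Membership.Propositional using (_∈_)
import Data.List.Membership.DecPropositional as DecMembership
open import Function.Bundles using (_⇔_; mk⇔)
open import Relation.Nullary using (yes; no)
open import Relation.Binary.PropositionalEquality

≤ˢ-reflexive : ∀ {s t} → s ≡ t → s ≤ˢ t
≤ˢ-reflexive { + } refl = +≤+
≤ˢ-reflexive { - } refl = -≤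

≤ˢ-antisym : ∀ {s t} → s ≤ˢ t → t ≤ˢ s → s ≡ t
≤ˢ-antisym -≤  -≤ = refl
≤ˢ-antisym +≤+ _  = refl

*ˢ≡+⇒≡ : ∀ s t → s *ˢ t ≡ + → s ≡ t
*ˢ≡+⇒≡ s t st≡+ = sym (*-cancelˡ-≡ s t s (trans st≡+ (sym (s*s≡+ s))))

module WalkProperties {k : ℕ} {Adj : Fin k → Fin k → Set}
                      (sg : ∀ {u v} → Adj u v → Sign) where

  open DecMembership (_≟_ {k}) using (_∈?_)

  infixr 5 _++ᵂ_

  _++ᵂ_ : ∀ {u v w} → Walk Adj u v → Walk Adj v w → Walk Adj u w
  [ _ ]      ++ᵂ q = q
  step u e p ++ᵂ q = step u e (p ++ᵂ q)

  len-++ᵂ : ∀ {u v w} (p : Walk Adj u v) (q : Walk Adj v w) →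
            len Adj (p ++ᵂ q) ≡ len Adj p +ℕ len Adj q
  len-++ᵂ [ _ ]        q = refl
  len-++ᵂ (step _ _ p) q = cong suc (len-++ᵂ p q)

  walkSign-++ᵂ : ∀ {u v w} (p : Walk Adj u v) (q : Walk Adj v w) →
                 walkSign Adj sg (p ++ᵂ q) ≡ walkSign Adj sg p *ˢ walkSign Adj sg q
  walkSign-++ᵂ [ _ ]        q = refl
  walkSign-++ᵂ (step _ e p) q =
    trans (cong (sg e *ˢ_) (walkSign-++ᵂ p q)) (sym (*-assoc (sg e) _ _))

  IsPath-++ᵂ⁻ʳ : ∀ {u v w} (p : Walk Adj u v) {q : Walk Adj v w} →
                 IsPath Adj (p ++ᵂ q) → IsPath Adj q
  IsPath-++ᵂ⁻ʳ [ _ ]        q-path       = q-path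
  IsPath-++ᵂ⁻ʳ (step _ _ p) (_ ∷ p-path) = IsPath-++ᵂ⁻ʳ p p-path

  splitAt : ∀ {u v w} (q : Walk Adj v w) → u ∈ verts Adj q →
            Σ (Walk Adj v u) λ p → Σ (Walk Adj u w) λ r → p ++ᵂ r ≡ q
  splitAt [ v ]        (here refl) = [ v ] , [ v ] , refl
  splitAt (step v e q) (here refl) = [ v ] , step v e q , refl
  splitAt (step v e q) (there u∈q) with splitAt q u∈q
  ... | p , r , refl = step v e p , r , refl

  PositiveClosedWalksUpTo : ℕ → Set
  PositiveClosedWalksUpTo N =
    ∀ {u} (c : Walk Adj u u) → len Adj c ≤ N → walkSign Adj sg c ≡ +

  record PathShortcut {u v} (p : Walk Adj u v) : Set where
    constructor shortcut
    field
      path      : Walk Adj u v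
      isPath    : IsPath Adj path
      len≤      : len Adj path ≤ len Adj p
      walkSign≡ : walkSign Adj sg path ≡ walkSign Adj sg p

  -- Shortcut the tail to a path q; if u reappears on q, drop the closed walk
  -- from u to that occurrence, which is positive by hypothesis.
  pathShortcut : ∀ {u v} (p : Walk Adj u v) →
                 PositiveClosedWalksUpTo (len Adj p) → PathShortcut p
  pathShortcut [ v ] _ = shortcut [ v ] ([] ∷ []) z≤n refl
  pathShortcut (step u e p) positive
    with pathShortcut p (λ c c≤p → positive c (≤-trans c≤p (n≤1+n _)))
  ... | shortcut q q-path q≤p q-sign with u ∈? verts Adj q
  ... | no u∉q =
    shortcut (step u e q) (¬Any⇒All¬ _ u∉q ∷ q-path) (s≤s q≤p) (cong (sg e *ˢ_) q-sign)
  ... | yes u∈q with splitAt q u∈q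
  ...   | pre , suf , refl = shortcut suf (IsPath-++ᵂ⁻ʳ pre q-path) suf≤ suf-sign
    where
    open ≡-Reasoning

    pre≤p : len Adj pre ≤ len Adj p
    pre≤p = ≤-trans (subst (len Adj pre ≤_) (sym (len-++ᵂ pre suf)) (m≤m+n _ _)) q≤p

    suf≤ : len Adj suf ≤ suc (len Adj p)
    suf≤ = ≤-trans (subst (len Adj suf ≤_) (sym (len-++ᵂ pre suf)) (m≤n+m _ _))
                   (≤-trans q≤p (n≤1+n _))

    loop-positive : sg e *ˢ walkSign Adj sg pre ≡ +
    loop-positive = positive (step u e pre) (s≤s pre≤p)

    suf-sign : walkSign Adj sg suf ≡ sg e *ˢ walkSign Adj sg p
    suf-sign = begin
      walkSign Adj sg suf                                  ≡⟨ cong (_*ˢ walkSign Adj sg suf) (sym loop-positive) ⟩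
      (sg e *ˢ walkSign Adj sg pre) *ˢ walkSign Adj sg suf ≡⟨ *-assoc (sg e) _ _ ⟩
      sg e *ˢ (walkSign Adj sg pre *ˢ walkSign Adj sg suf) ≡⟨ cong (sg e *ˢ_) (sym (walkSign-++ᵂ pre suf)) ⟩
      sg e *ˢ walkSign Adj sg (pre ++ᵂ suf)                ≡⟨ cong (sg e *ˢ_) q-sign ⟩
      sg e *ˢ walkSign Adj sg p                            ∎

module WalkMaps {k : ℕ} {A B : Fin k → Fin k → Set}
                (sgA : ∀ {u v} → A u v → Sign) (sgB : ∀ {u v} → B u v → Sign) where

  mapᵂ : (∀ {u v} → A u v → B u v) → ∀ {u v} → Walk A u v → Walk B u v
  mapᵂ f [ v ]        = [ v ]
  mapᵂ f (step u e p) = step u (f e) (mapᵂ f p)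

  module _ (f : ∀ {u v} → A u v → B u v) where

    verts-mapᵂ : ∀ {u v} (p : Walk A u v) → verts B (mapᵂ f p) ≡ verts A p
    verts-mapᵂ [ v ]        = refl
    verts-mapᵂ (step u e p) = cong (u ∷_) (verts-mapᵂ p)

    len-mapᵂ : ∀ {u v} (p : Walk A u v) → len B (mapᵂ f p) ≡ len A p
    len-mapᵂ [ v ]        = refl
    len-mapᵂ (step u e p) = cong suc (len-mapᵂ p)

    IsCycle-mapᵂ : ∀ {u} (c : Walk A u u) → IsCycle A c → IsCycle B (mapᵂ f c)
    IsCycle-mapᵂ c (3≤c , c-unique) =
      subst (3 ≤_) (sym (len-mapᵂ c)) 3≤c ,
      subst (λ xs → Unique (drop 1 xs)) (sym (verts-mapᵂ c)) c-unique

    module _ (f-sign : ∀ {u v} (e : A u v) → sgB (f e) ≡ sgA e) where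

      walkSign-mapᵂ : ∀ {u v} (p : Walk A u v) → walkSign B sgB (mapᵂ f p) ≡ walkSign A sgA p
      walkSign-mapᵂ [ v ]        = refl
      walkSign-mapᵂ (step u e p) = cong₂ _*ˢ_ (f-sign e) (walkSign-mapᵂ p)

      Balanced-reflect : Balanced B sgB → Balanced A sgA
      Balanced-reflect balanced c c-cycle =
        trans (sym (walkSign-mapᵂ c)) (balanced (mapᵂ f c) (IsCycle-mapᵂ c c-cycle))

  open WalkProperties {Adj = B} sgB using (_++ᵂ_; walkSign-++ᵂ)

  concatMapᵂ : (∀ {u v} → A u v → Walk B u v) → ∀ {u v} → Walk A u v → Walk B u v
  concatMapᵂ f [ v ]        = [ v ]
  concatMapᵂ f (step u e p) = f e ++ᵂ concatMapᵂ f p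

  walkSign-concatMapᵂ : (f : ∀ {u v} → A u v → Walk B u v) →
                        (∀ {u v} (e : A u v) → walkSign B sgB (f e) ≡ sgA e) →
                        ∀ {u v} (p : Walk A u v) →
                        walkSign B sgB (concatMapᵂ f p) ≡ walkSign A sgA p
  walkSign-concatMapᵂ f f-sign [ v ]        = refl
  walkSign-concatMapᵂ f f-sign (step u e p) =
    trans (walkSign-++ᵂ (f e) (concatMapᵂ f p))
          (cong₂ _*ˢ_ (f-sign e) (walkSign-concatMapᵂ f f-sign p))

module SignedGraphWalks {k : ℕ} (S : SignedGraph k) where
  open SignedGraph S
  open WalkProperties {Adj = E S} (σ S)

  sign : ∀ {u v} → Walk (E S) u v → Sign
  sign = walkSign (E S) (σ S)

  edge⇒≢ : ∀ {u v} → E S u v → u ≢ v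
  edge⇒≢ {u} uu refl with trans (sym uu) (adj-irr u)
  ... | ()

  edge-sym : ∀ {u v} → E S u v → E S v u
  edge-sym {u} {v} uv = trans (adj-sym v u) uv

  reverse : ∀ {u v} → Walk (E S) u v → Walk (E S) v u
  reverse [ v ]            = [ v ]
  reverse (step u {v} e p) = reverse p ++ᵂ step v (edge-sym e) [ u ]

  sign-reverse : ∀ {u v} (p : Walk (E S) u v) → sign (reverse p) ≡ sign p
  sign-reverse [ v ] = refl
  sign-reverse (step u {v} e p) = begin
    sign (reverse p ++ᵂ step v (edge-sym e) [ u ]) ≡⟨ walkSign-++ᵂ (reverse p) _ ⟩
    sign (reverse p) *ˢ (sgn v u *ˢ +)             ≡⟨ cong₂ _*ˢ_ (sign-reverse p) (*-identityʳ (sgn v u)) ⟩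
    sign p *ˢ sgn v u                              ≡⟨ cong (sign p *ˢ_) (sgn-sym v u) ⟩
    sign p *ˢ sgn u v                              ≡⟨ *-comm (sign p) (sgn u v) ⟩
    sgn u v *ˢ sign p                              ∎
    where open ≡-Reasoning

  module _ (balanced : Balanced (E S) (σ S)) where

    -- Closing a path with an edge gives either a cycle or a backtrack u v u.
    closedPath-positive : ∀ {u v} (e : E S u v) (p : Walk (E S) v u) → IsPath (E S) p →
                          sign (step u e p) ≡ +
    closedPath-positive e [ _ ] _ = ⊥-elim (edge⇒≢ e refl)
    closedPath-positive {u} {v} e (step _ _ [ _ ]) _ =
      trans (cong (sgn u v *ˢ_) (trans (*-identityʳ (sgn v u)) (sgn-sym v u))) (s*s≡+ (sgn u v))
    closedPath-positive {u} e p@(step _ _ (step _ _ _)) p-path =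
      balanced (step u e p) (s≤s (s≤s (s≤s z≤n)) , p-path)

    closedWalks-positiveUpTo : ∀ N → PositiveClosedWalksUpTo N
    closedWalks-positiveUpTo _       [ u ]            _         = refl
    closedWalks-positiveUpTo (suc N) (step u {v} e p) (s≤s p≤N)
      with pathShortcut p (λ c c≤p → closedWalks-positiveUpTo N c (≤-trans c≤p p≤N))
    ... | shortcut q q-path _ q-sign =
      trans (cong (sgn u v *ˢ_) (sym q-sign)) (closedPath-positive e q q-path)

    closedWalk-positive : ∀ {u} (c : Walk (E S) u u) → sign c ≡ +
    closedWalk-positive c = closedWalks-positiveUpTo _ c ≤-refl

    sign-unique : ∀ {u v} (p q : Walk (E S) u v) → sign p ≡ sign q
    sign-unique p q = *ˢ≡+⇒≡ (sign p) (sign q) (begin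
      sign p *ˢ sign q           ≡⟨ cong (sign p *ˢ_) (sym (sign-reverse q)) ⟩
      sign p *ˢ sign (reverse q) ≡⟨ sym (walkSign-++ᵂ p (reverse q)) ⟩
      sign (p ++ᵂ reverse q)     ≡⟨ closedWalk-positive (p ++ᵂ reverse q) ⟩
      +                          ∎)
      where open ≡-Reasoning

    walk⇒shortestPath : ∀ {u v m} (p : Walk (E S) u v) → Dist (E S) u v m → len (E S) p ≡ m →
                        Σ (Walk (E S) u v) λ q → IsShortestPath (E S) q × sign q ≡ sign p
    walk⇒shortestPath p (_ , m-min) p≡m =
      path , (isPath , (path , refl) , path-minimal) , walkSign≡
      where
      open PathShortcut (pathShortcut p (λ c _ → closedWalk-positive c))
      path-minimal : ∀ r → len (E S) path ≤ len (E S) r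
      path-minimal r = ≤-trans len≤ (subst (_≤ len (E S) r) (sym p≡m) (m-min r))

module PowerGraph {k : ℕ} (S : SignedGraph k) (n : ℕ) where
  open SignedGraph S
  open SignedGraphWalks S

  powerWalk : ∀ {u v} → PowAdj S n u v → Walk (E S) u v
  powerWalk (_ , _ , ((p , _) , _) , _) = p

  powerSign : ∀ {u v} → PowAdj S n u v → Sign
  powerSign e = sign (powerWalk e)

  uniquePowerSign-shortestPath : (σ' : ∀ {u v} → PowAdj S n u v → Sign) →
                                 IsUniquePowerSignature S n σ' →
                                 ∀ {u v} (e : PowAdj S n u v) (p : Walk (E S) u v) →
                                 IsShortestPath (E S) p → σ' e ≡ sign p
  uniquePowerSign-shortestPath σ' unique e p p-shortest =
    ≤ˢ-antisym (proj₂ (proj₂ (unique e)) p p-shortest) (proj₂ (proj₁ (unique e)) p p-shortest)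

  module _ (balanced : Balanced (E S) (σ S)) where

    powerSign-unique : IsUniquePowerSignature S n powerSign
    powerSign-unique {u} {v} (_ , _ , dist@((p , p≡m) , _) , _) =
      (shortest , λ q _ → ≤ˢ-reflexive (sign-unique balanced q p)) ,
      (shortest , λ q _ → ≤ˢ-reflexive (sign-unique balanced p q))
      where
      shortest : Σ (Walk (E S) u v) λ q → IsShortestPath (E S) q × sign q ≡ sign p
      shortest = walk⇒shortestPath balanced p dist p≡m

    powerSign-balanced : Balanced (PowAdj S n) powerSign
    powerSign-balanced c _ =
      trans (sym (walkSign-concatMapᵂ powerWalk (λ _ → refl) c))
            (closedWalk-positive balanced (concatMapᵂ powerWalk c))
      where open WalkMaps {A = PowAdj S n} {B = E S} powerSign (σ S)

  module _ (1≤n : 1 ≤ n) where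

    edge-dist : ∀ {u v} → E S u v → Dist (E S) u v 1
    edge-dist {u} {v} e = (step u e [ v ] , refl) , minimal
      where
      minimal : (q : Walk (E S) u v) → 1 ≤ len (E S) q
      minimal [ _ ]        = ⊥-elim (edge⇒≢ e refl)
      minimal (step _ _ _) = s≤s z≤n

    edge⇒powerAdj : ∀ {u v} → E S u v → PowAdj S n u v
    edge⇒powerAdj e = edge⇒≢ e , 1 , edge-dist e , 1≤n

    uniquePowerSign-edge : (σ' : ∀ {u v} → PowAdj S n u v → Sign) → IsUniquePowerSignature S n σ' →
                           ∀ {u v} (e : E S u v) → σ' (edge⇒powerAdj e) ≡ σ S e
    uniquePowerSign-edge σ' unique {u} {v} e =
      trans (uniquePowerSign-shortestPath σ' unique (edge⇒powerAdj e) edge edge-shortest)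
            (*-identityʳ (sgn u v))
      where
      edge : Walk (E S) u v
      edge = step u e [ v ]
      edge-shortest : IsShortestPath (E S) edge
      edge-shortest = ((edge⇒≢ e ∷ []) ∷ [] ∷ []) , edge-dist e

theorem2p14 : ∀ {k : ℕ} (S : SignedGraph k) (n : ℕ) → 1 ≤ n →
    TwoConnected (E S) →
    Balanced (E S) (σ S)
      ⇔ Σ (∀ {u v} → PowAdj S n u v → Sign)
          (λ σ' → IsUniquePowerSignature S n σ' × Balanced (PowAdj S n) σ')
theorem2p14 S n 1≤n _ = mk⇔ balanced⇒power balanced⇐power
  where
  open PowerGraph S n

  balanced⇒power : Balanced (E S) (σ S) →
                   Σ (∀ {u v} → PowAdj S n u v → Sign)
                     (λ σ' → IsUniquePowerSignature S n σ' × Balanced (PowAdj S n) σ')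
  balanced⇒power balanced =
    powerSign , powerSign-unique balanced , powerSign-balanced balanced

  balanced⇐power : Σ (∀ {u v} → PowAdj S n u v → Sign)
                     (λ σ' → IsUniquePowerSignature S n σ' × Balanced (PowAdj S n) σ') →
                   Balanced (E S) (σ S)
  balanced⇐power (σ' , unique , power-balanced) =
    WalkMaps.Balanced-reflect {A = E S} {B = PowAdj S n} (σ S) σ' (edge⇒powerAdj 1≤n)
      (uniquePowerSign-edge 1≤n σ' unique) power-balanced
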